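{- Let $G$ be a finite group. Then $G$ is an elementary abelian $2$-group of rank at least $2$ if and only if the power graph $\mathcal{G}(G)$ is non-complete and minimally connected.
   Context: The power graph $\mathcal{G}(G)$ of a group $G$ is the simple undirected graph with vertex set $G$ in which two distinct vertices $u,v$ are adjacent if and only if $v=u^n$ for some positive integer $n$ or $u=v^m$ for some positive integer $m$. For a graph $\Gamma$, $\kappa(\Gamma)$ denotes its vertex connectivity. A non-trivial connected graph $\Gamma$ is minimally connected if $\kappa(\Gamma-\varepsilon)=\kappa(\Gamma)-1$ for every edge $\varepsilon$ of $\Gamma$. -}

module Defs where

open import Level using (0ℓ)
open import Data.Nat using (ℕ; zero; suc; _≤_; _∸_; _^_)
open import Data.Fin using (Fin)
open import Data.Fin.Subset using (Subset; _∈_; _∉_; ∣_∣; ∁) renaming (⊤ to Full)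
open import Data.Product using (Σ; ∃; _×_; _,_)
open import Data.Sum using (_⊎_)
open import Relation.Nullary using (¬_)
open import Relation.Binary.PropositionalEquality using (_≡_; _≢_)
open import Algebra.Structures using (IsGroup)
open import Algebra.Definitions using (Commutative)

-- Finite groups: a group whose carrier is Fin n (every finite group of
-- order n is isomorphic to one of these), with propositional equality.

record FinGroup (n : ℕ) : Set where
  field
    _∙_     : Fin n → Fin n → Fin n
    ε       : Fin n
    _⁻¹     : Fin n → Fin n
    isGroup : IsGroup {A = Fin n} _≡_ _∙_ ε _⁻¹

pow : ∀ {n} → FinGroup n → Fin n → ℕ → Fin n
pow G x zero    = FinGroup.ε G
pow G x (suc k) = FinGroup._∙_ G x (pow G x k)

IsElemAbelian2OfRank : ∀ {n} → FinGroup n → ℕ → Set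
IsElemAbelian2OfRank {n} G r =
  Commutative {A = Fin n} _≡_ (FinGroup._∙_ G)
  × (∀ x → FinGroup._∙_ G x x ≡ FinGroup.ε G)
  × n ≡ 2 ^ r

Graph : ℕ → Set₁
Graph n = Fin n → Fin n → Set

PowerGraph : ∀ {n} → FinGroup n → Graph n
PowerGraph G u v =
  u ≢ v ×
  ((Σ ℕ λ k → 1 ≤ k × v ≡ pow G u k) ⊎ (Σ ℕ λ m → 1 ≤ m × u ≡ pow G v m))

IsComplete : ∀ {n} → Graph n → Set
IsComplete {n} Γ = ∀ (u v : Fin n) → u ≢ v → Γ u v

data Reach {n} (Γ : Graph n) (W : Subset n) : Fin n → Fin n → Set where
  here  : ∀ {u} → u ∈ W → Reach Γ W u u
  there : ∀ {u v w} → u ∈ W → Γ u v → Reach Γ W v w → Reach Γ W u w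

IsConnected : ∀ {n} → Graph n → Set
IsConnected {n} Γ = ∀ (u v : Fin n) → Reach Γ Full u v

IsSeparating : ∀ {n} → Graph n → Subset n → Set
IsSeparating {n} Γ S =
  (Σ (Fin n) λ u → Σ (Fin n) λ v → u ∉ S × v ∉ S × ¬ Reach Γ (∁ S) u v)
  ⊎ ∣ ∁ S ∣ ≤ 1

IsVertexConnectivity : ∀ {n} → Graph n → ℕ → Set
IsVertexConnectivity {n} Γ k =
  (Σ (Subset n) λ S → IsSeparating Γ S × ∣ S ∣ ≡ k)
  × (∀ S → IsSeparating Γ S → k ≤ ∣ S ∣)

IsEdge : ∀ {n} → Graph n → Fin n → Fin n → Set
IsEdge Γ a b = Γ a b

DeleteEdge : ∀ {n} → Graph n → Fin n → Fin n → Graph n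
DeleteEdge Γ a b x y = Γ x y × ¬ ((x ≡ a × y ≡ b) ⊎ (x ≡ b × y ≡ a))

IsMinimallyConnected : ∀ {n} → Graph n → Set
IsMinimallyConnected {n} Γ =
  2 ≤ n × IsConnected Γ ×
  (∀ k → IsVertexConnectivity Γ k →
     ∀ a b → IsEdge Γ a b → IsVertexConnectivity (DeleteEdge Γ a b) (k ∸ 1))

module Submission where

-- In a group of exponent 2 every non-identity element is adjacent only to ε, so the power graph
-- is a star; with at least three vertices it is not complete, {ε} separates it, and deleting any
-- edge isolates a leaf, so the connectivity drops from 1 to 0.
-- Conversely, if x² ≠ ε then x ≠ x⁻¹, and since x and x⁻¹ are powers of each other they are
-- adjacent twins of the power graph. Deleting the edge between adjacent twins lowers the
-- connectivity only of a complete graph: a separator of Γ − xx⁻¹ that does not separate Γ leaves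
-- only x and x⁻¹, so it has n − 2 vertices, and then every non-adjacent pair would yield a
-- separator that is too small. Hence the group has exponent 2; it is then abelian, its order is a
-- power of 2 (double a subgroup H to H ∪ gH until it is everything), and the rank is at least 2
-- since on at most two vertices the power graph is complete.

open import Defs

open import Level using (0ℓ)
open import Function using (_∘_)
open import Function.Bundles using (_⇔_; mk⇔; Equivalence)
open import Data.Empty using (⊥-elim)
open import Data.Product using (Σ; _×_; _,_; proj₁; proj₂)
open import Data.Sum using (_⊎_; inj₁; inj₂; [_,_]′)
open import Data.Bool using (Bool; true; false; T; T?; _∨_; if_then_else_)
open import Data.Bool.Properties using (T-∨)
open import Data.Nat using (ℕ; zero; suc; _+_; _*_; _∸_; _^_; _≤_; _<_; z≤n; s≤s)
import Data.Nat.Properties as ℕ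
open import Data.Nat.DivMod using (_%_; _/_; m≡m%n+[m/n]*n; m%n<n)
open import Data.Nat.Induction using (<-rec)
open import Data.Fin using (Fin; zero; suc; toℕ; fromℕ<; punchIn; _≟_)
open import Data.Fin.Properties using (pigeonhole; any?; toℕ-fromℕ<; punchInᵢ≢i; punchIn-injective)
open import Data.Fin.Permutation using (permutation)
open import Data.Fin.Subset using (Subset; _∈_; _∉_; _⊆_; ∣_∣; ∁; ⁅_⁆; _∪_; ⊤; inside; outside)
  renaming (⊥ to ∅)
open import Data.Fin.Subset.Properties
  using (_∈?_; ∈⊤; ∉⊥; ∣⊥∣≡0; ∣⊤∣≡n; ∣⁅x⁆∣≡1; ∣∁p∣≡n∸∣p∣; ∣p∣≤∣x∷p∣; x∈⁅x⁆; x∈⁅y⁆⇒x≡y;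
         p⊆q⇒∣p∣≤∣q∣; p⊂q⇒∣p∣<∣q∣; q⊆p∪q; x∈p∪q⁺; x∈p∪q⁻; x∉p⇒x∈∁p; x∈p⇒x∉∁p; x∉∁p⇒x∈p; x∈∁p⇒x∉p)
open import Data.Vec using (_∷_; [])
open import Relation.Nullary using (¬_; yes; no)
open import Relation.Nullary.Decidable
  using (map′; isYes; toWitness; fromWitness; ¬?; decidable-stable; _×-dec_; _⊎-dec_)
open import Relation.Binary.Definitions using (Symmetric; Irreflexive; Decidable)
open import Relation.Binary.PropositionalEquality
open import Algebra.Bundles using (Group)
open import Algebra.Structures using (IsGroup)
open import Algebra.Definitions using (Commutative)
import Algebra.Properties.Group as GroupProperties
import Algebra.Properties.Loop as LoopProperties
open import Algebra.Properties.CommutativeMonoid.Sum ℕ.+-0-commutativeMonoid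
  using (sum; sum-remove; sum-cong-≗; ∑-distrib-+; sum-permute)

reach-trans : ∀ {n} {Γ : Graph n} {W u v w} → Reach Γ W u v → Reach Γ W v w → Reach Γ W u w
reach-trans (here _)            r′ = r′
reach-trans (there u∈W Γuv r) r′ = there u∈W Γuv (reach-trans r r′)

reach-mono : ∀ {n} {Γ : Graph n} {W W′ u v} → W ⊆ W′ → Reach Γ W u v → Reach Γ W′ u v
reach-mono W⊆W′ (here u∈W)        = here (W⊆W′ u∈W)
reach-mono W⊆W′ (there u∈W Γuv r) = there (W⊆W′ u∈W) Γuv (reach-mono W⊆W′ r)

reach-source : ∀ {n} {Γ : Graph n} {W u v} → Reach Γ W u v → u ∈ W
reach-source (here u∈W)      = u∈W
reach-source (there u∈W _ _) = u∈W

∣p∪q∣≤∣p∣+∣q∣ : ∀ {m} (p q : Subset m) → ∣ p ∪ q ∣ ≤ ∣ p ∣ + ∣ q ∣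
∣p∪q∣≤∣p∣+∣q∣ []           []           = z≤n
∣p∪q∣≤∣p∣+∣q∣ (inside ∷ p)  (s ∷ q)      =
  s≤s (ℕ.≤-trans (∣p∪q∣≤∣p∣+∣q∣ p q) (ℕ.+-monoʳ-≤ ∣ p ∣ (∣p∣≤∣x∷p∣ s q)))
∣p∪q∣≤∣p∣+∣q∣ (outside ∷ p) (inside ∷ q)  =
  ℕ.≤-trans (s≤s (∣p∪q∣≤∣p∣+∣q∣ p q)) (ℕ.≤-reflexive (sym (ℕ.+-suc ∣ p ∣ ∣ q ∣)))
∣p∪q∣≤∣p∣+∣q∣ (outside ∷ p) (outside ∷ q) = ∣p∪q∣≤∣p∣+∣q∣ p q

∣⁅a⁆∪⁅b⁆∣≤2 : ∀ {m} (a b : Fin m) → ∣ ⁅ a ⁆ ∪ ⁅ b ⁆ ∣ ≤ 2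
∣⁅a⁆∪⁅b⁆∣≤2 a b =
  subst₂ (λ s t → ∣ ⁅ a ⁆ ∪ ⁅ b ⁆ ∣ ≤ s + t) (∣⁅x⁆∣≡1 a) (∣⁅x⁆∣≡1 b) (∣p∪q∣≤∣p∣+∣q∣ ⁅ a ⁆ ⁅ b ⁆)

∣⁅a⁆∪⁅b⁆∣≥2 : ∀ {m} {a b : Fin m} → a ≢ b → 2 ≤ ∣ ⁅ a ⁆ ∪ ⁅ b ⁆ ∣
∣⁅a⁆∪⁅b⁆∣≥2 {a = a} {b} a≢b = subst (λ t → suc t ≤ ∣ ⁅ a ⁆ ∪ ⁅ b ⁆ ∣) (∣⁅x⁆∣≡1 b)
  (p⊂q⇒∣p∣<∣q∣ (q⊆p∪q ⁅ a ⁆ ⁅ b ⁆ , a , x∈p∪q⁺ (inj₁ (x∈⁅x⁆ a)) , a≢b ∘ x∈⁅y⁆⇒x≡y b))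

∣∁T∣≤2⇒n∸2≤∣T∣ : ∀ {n} {T : Subset n} → ∣ ∁ T ∣ ≤ 2 → n ∸ 2 ≤ ∣ T ∣
∣∁T∣≤2⇒n∸2≤∣T∣ {n} {T} ∣∁T∣≤2 = ℕ.m≤n+o⇒m∸n≤o n 2 (begin
  n                   ≤⟨ ℕ.m≤n+m∸n n ∣ T ∣ ⟩
  ∣ T ∣ + (n ∸ ∣ T ∣)  ≡⟨ cong (∣ T ∣ +_) (∣∁p∣≡n∸∣p∣ T) ⟨
  ∣ T ∣ + ∣ ∁ T ∣      ≤⟨ ℕ.+-monoʳ-≤ ∣ T ∣ ∣∁T∣≤2 ⟩
  ∣ T ∣ + 2           ≡⟨ ℕ.+-comm ∣ T ∣ 2 ⟩
  2 + ∣ T ∣           ∎)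
  where open ℕ.≤-Reasoning

fin≤2-pigeonhole : ∀ {m} → m ≤ 2 → (a b c : Fin m) → a ≡ b ⊎ a ≡ c ⊎ b ≡ c
fin≤2-pigeonhole _ zero       zero       _          = inj₁ refl
fin≤2-pigeonhole _ zero       (suc zero) zero       = inj₂ (inj₁ refl)
fin≤2-pigeonhole _ zero       (suc zero) (suc zero) = inj₂ (inj₂ refl)
fin≤2-pigeonhole _ (suc zero) zero       zero       = inj₂ (inj₂ refl)
fin≤2-pigeonhole _ (suc zero) zero       (suc zero) = inj₂ (inj₁ refl)
fin≤2-pigeonhole _ (suc zero) (suc zero) _          = inj₁ refl
fin≤2-pigeonhole (s≤s (s≤s z≤n)) (suc (suc ())) _ _
fin≤2-pigeonhole (s≤s (s≤s z≤n)) _ (suc (suc ())) _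
fin≤2-pigeonhole (s≤s (s≤s z≤n)) _ _ (suc (suc ()))

two-others : ∀ {m} → 3 ≤ m → (c : Fin m) → Σ (Fin m) λ u → Σ (Fin m) λ v → u ≢ c × v ≢ c × u ≢ v
two-others (s≤s (s≤s (s≤s _))) c =
  punchIn c zero , punchIn c (suc zero) , punchInᵢ≢i c zero , punchInᵢ≢i c (suc zero) ,
  (λ ()) ∘ punchIn-injective c zero (suc zero)

isolated⇒κ≡0 : ∀ {n} (Γ : Graph n) {u v} → v ≢ u → (∀ w → ¬ Γ u w) → IsVertexConnectivity Γ 0
isolated⇒κ≡0 {n} Γ {u} {v} v≢u isolated = (∅ , inj₁ (u , v , ∉⊥ , ∉⊥ , stuck) , ∣⊥∣≡0 n) , λ _ _ → z≤n
  where
    stuck : ¬ Reach Γ (∁ ∅) u v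
    stuck (here _)        = v≢u refl
    stuck (there _ Γuw _) = isolated _ Γuw

module GraphProperties {n : ℕ} (Γ : Graph n) where

  SeparatorOfSize : ℕ → Set
  SeparatorOfSize m = Σ (Subset n) λ S → IsSeparating Γ S × ∣ S ∣ ≡ m

  ⊤-separates : IsSeparating Γ ⊤
  ⊤-separates = inj₂ (subst (_≤ 1) (sym (begin
    ∣ ∁ (⊤ {n}) ∣ ≡⟨ ∣∁p∣≡n∸∣p∣ (⊤ {n}) ⟩
    n ∸ ∣ ⊤ {n} ∣ ≡⟨ cong (n ∸_) (∣⊤∣≡n n) ⟩
    n ∸ n         ≡⟨ ℕ.n∸n≡0 n ⟩
    0             ∎)) z≤n)
    where open ≡-Reasoning

  -- Constructively κ(Γ) need not be computable, but the least separator size exists up to ¬¬.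
  ¬¬-vertexConnectivity : ¬ ¬ Σ ℕ (IsVertexConnectivity Γ)
  ¬¬-vertexConnectivity ¬κ =
    <-rec (λ m → ¬ SeparatorOfSize m) least-size ∣ ⊤ {n} ∣ (⊤ , ⊤-separates , refl)
    where
      least-size : ∀ m → (∀ {m′} → m′ < m → ¬ SeparatorOfSize m′) → ¬ SeparatorOfSize m
      least-size m smaller separator = ¬κ (m , separator , minimal)
        where
          minimal : ∀ S → IsSeparating Γ S → m ≤ ∣ S ∣
          minimal S S-separates with m ℕ.≤? ∣ S ∣
          ... | yes m≤∣S∣ = m≤∣S∣
          ... | no m≰∣S∣  = ⊥-elim (smaller (ℕ.≰⇒> m≰∣S∣) (S , S-separates , refl))

  ∣S∣≡0⇒∉S : ∀ {S : Subset n} → ∣ S ∣ ≡ 0 → ∀ {i} → i ∉ S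
  ∣S∣≡0⇒∉S {S} ∣S∣≡0 {i} i∈S = ℕ.n≮0 (subst (1 ≤_) ∣S∣≡0 ⁅i⁆≤S)
    where
      ⁅i⁆≤S : 1 ≤ ∣ S ∣
      ⁅i⁆≤S = subst (_≤ ∣ S ∣) (∣⁅x⁆∣≡1 i)
                (p⊆q⇒∣p∣≤∣q∣ λ j∈⁅i⁆ → subst (_∈ S) (sym (x∈⁅y⁆⇒x≡y i j∈⁅i⁆)) i∈S)

  connected⇒¬separating-∅ : 2 ≤ n → IsConnected Γ → ∀ S → ∣ S ∣ ≡ 0 → ¬ IsSeparating Γ S
  connected⇒¬separating-∅ 2≤n _ S ∣S∣≡0 (inj₂ ∣∁S∣≤1) =
    ℕ.<⇒≱ 2≤n (subst (_≤ 1) (trans (∣∁p∣≡n∸∣p∣ S) (cong (n ∸_) ∣S∣≡0)) ∣∁S∣≤1)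
  connected⇒¬separating-∅ _ connected S ∣S∣≡0 (inj₁ (u , v , _ , _ , ¬reach)) =
    ¬reach (reach-mono (λ _ → x∉p⇒x∈∁p (∣S∣≡0⇒∉S ∣S∣≡0)) (connected u v))

  below-connectivity⇒¬separating : 2 ≤ n → IsConnected Γ → ∀ {k} → IsVertexConnectivity Γ k →
                                   ∀ T → ∣ T ∣ ≤ k ∸ 1 → ¬ IsSeparating Γ T
  below-connectivity⇒¬separating 2≤n connected {zero} _ T ∣T∣≤0 =
    connected⇒¬separating-∅ 2≤n connected T (ℕ.n≤0⇒n≡0 ∣T∣≤0)
  below-connectivity⇒¬separating _ _ {suc k} (_ , minimal) T ∣T∣≤k T-separates =
    ℕ.n≮n k (ℕ.≤-trans (minimal T T-separates) ∣T∣≤k)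

  pair-separates : Irreflexive _≡_ Γ → ∀ {a b} → a ≢ b → ¬ Γ a b → IsSeparating Γ (∁ (⁅ a ⁆ ∪ ⁅ b ⁆))
  pair-separates irrefl {a} {b} a≢b ¬Γab =
    inj₁ (a , b , x∈p⇒x∉∁p (x∈p∪q⁺ (inj₁ (x∈⁅x⁆ a))) , x∈p⇒x∉∁p (x∈p∪q⁺ (inj₂ (x∈⁅x⁆ b))) , stuck)
    where
      stuck : ¬ Reach Γ (∁ (∁ (⁅ a ⁆ ∪ ⁅ b ⁆))) a b
      stuck (here _) = a≢b refl
      stuck (there _ Γac r) with x∈p∪q⁻ ⁅ a ⁆ ⁅ b ⁆ (x∉∁p⇒x∈p (x∈∁p⇒x∉p (reach-source r)))
      ... | inj₁ c∈⁅a⁆ = irrefl (sym (x∈⁅y⁆⇒x≡y a c∈⁅a⁆)) Γac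
      ... | inj₂ c∈⁅b⁆ = ¬Γab (subst (Γ a) (x∈⁅y⁆⇒x≡y b c∈⁅b⁆) Γac)

  complete-if-¬separating-n∸2 : Decidable Γ → Irreflexive _≡_ Γ →
                                (∀ S → ∣ S ∣ ≤ n ∸ 2 → ¬ IsSeparating Γ S) → IsComplete Γ
  complete-if-¬separating-n∸2 Γ? irrefl no-separator a b a≢b with Γ? a b
  ... | yes Γab = Γab
  ... | no ¬Γab = ⊥-elim (no-separator _ ∣∁pair∣≤n∸2 (pair-separates irrefl a≢b ¬Γab))
    where
      ∣∁pair∣≤n∸2 : ∣ ∁ (⁅ a ⁆ ∪ ⁅ b ⁆) ∣ ≤ n ∸ 2
      ∣∁pair∣≤n∸2 = subst (_≤ n ∸ 2) (sym (∣∁p∣≡n∸∣p∣ (⁅ a ⁆ ∪ ⁅ b ⁆))) (ℕ.∸-monoʳ-≤ n (∣⁅a⁆∪⁅b⁆∣≥2 a≢b))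

  Twins : Fin n → Fin n → Set
  Twins x y = ∀ {z} → z ≢ y → Γ z x → Γ z y

  module TwinEdge (Γ-sym : Symmetric Γ) {x y} (x≢y : x ≢ y) (x~y : Twins x y) (y~x : Twins y x) where

    Γ′ : Graph n
    Γ′ = DeleteEdge Γ x y

    kept-edge : ∀ {u v} → Γ u v → ¬ (u ≡ x × v ≡ y) → ¬ (u ≡ y × v ≡ x) → Γ′ u v
    kept-edge Γuv ¬xy ¬yx = Γuv , [ ¬xy , ¬yx ]′

    Detour : Subset n → Set
    Detour W = x ∈ W → y ∈ W → Reach Γ′ W x y × Reach Γ′ W y x

    detour-lifts : ∀ {W a b} → Detour W → Reach Γ W a b → Reach Γ′ W a b
    detour-lifts d (here a∈W) = here a∈W
    detour-lifts d (there {a} {c} a∈W Γac r)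
      with ((a ≟ x) ×-dec (c ≟ y)) ⊎-dec ((a ≟ y) ×-dec (c ≟ x))
    ... | no ¬deleted            = there a∈W (Γac , ¬deleted) (detour-lifts d r)
    ... | yes (inj₁ (refl , refl)) = reach-trans (proj₁ (d a∈W (reach-source r))) (detour-lifts d r)
    ... | yes (inj₂ (refl , refl)) = reach-trans (proj₂ (d (reach-source r) a∈W)) (detour-lifts d r)

    detour-via : ∀ {W c} → c ∈ W → c ≢ x → c ≢ y → Γ c x → Detour W
    detour-via {c = c} c∈W c≢x c≢y Γcx x∈W y∈W =
        there x∈W (kept-edge (Γ-sym Γcx) (c≢y ∘ proj₂) (x≢y ∘ proj₁))
          (there c∈W (kept-edge Γcy (c≢x ∘ proj₁) (c≢y ∘ proj₁)) (here y∈W))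
      , there y∈W (kept-edge (Γ-sym Γcy) (x≢y ∘ sym ∘ proj₁) (c≢x ∘ proj₂))
          (there c∈W (kept-edge Γcx (c≢x ∘ proj₁) (c≢y ∘ proj₁)) (here x∈W))
      where
        Γcy : Γ c y
        Γcy = x~y c≢y Γcx

    leave-pair : ∀ {W a b} → Reach Γ W a b → a ≡ x ⊎ a ≡ y → b ≢ x → b ≢ y →
                 Σ (Fin n) λ c → c ∈ W × c ≢ x × c ≢ y × Γ c x
    leave-pair (here _) (inj₁ refl) b≢x _ = ⊥-elim (b≢x refl)
    leave-pair (here _) (inj₂ refl) _ b≢y = ⊥-elim (b≢y refl)
    leave-pair (there {_} {c} _ Γac r) a∈xy b≢x b≢y with c ≟ x | c ≟ y
    ... | yes c≡x | _       = leave-pair r (inj₁ c≡x) b≢x b≢y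
    ... | no _    | yes c≡y = leave-pair r (inj₂ c≡y) b≢x b≢y
    ... | no c≢x  | no c≢y  = c , reach-source r , c≢x , c≢y , Γcx a∈xy
      where
        Γcx : _ ≡ x ⊎ _ ≡ y → Γ c x
        Γcx (inj₁ refl) = Γ-sym Γac
        Γcx (inj₂ refl) = y~x c≢x (Γ-sym Γac)

    -- A path of Γ avoiding T from x to a third vertex leaves {x, y} along an edge to some c; by
    -- twinship c is adjacent to both x and y, and x – c – y replaces the deleted edge.
    deletion-separator⊆ : ∀ {T} → ¬ IsSeparating Γ T → IsSeparating Γ′ T → ∁ T ⊆ ⁅ x ⁆ ∪ ⁅ y ⁆
    deletion-separator⊆ ¬sep (inj₂ ∣∁T∣≤1) _ = ⊥-elim (¬sep (inj₂ ∣∁T∣≤1))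
    deletion-separator⊆ {T} ¬sep (inj₁ (u , v , u∉T , v∉T , ¬reach′)) =
      only-x,y (λ d → ¬sep (inj₁ (u , v , u∉T , v∉T , ¬reach′ ∘ detour-lifts d)))
      where
        only-x,y : ¬ Detour (∁ T) → ∁ T ⊆ ⁅ x ⁆ ∪ ⁅ y ⁆
        only-x,y ¬detour {i} i∈W with i ≟ x | i ≟ y | x ∈? ∁ T | y ∈? ∁ T
        ... | yes refl | _        | _       | _       = x∈p∪q⁺ (inj₁ (x∈⁅x⁆ x))
        ... | no _     | yes refl | _       | _       = x∈p∪q⁺ (inj₂ (x∈⁅x⁆ y))
        ... | no _     | no _     | no x∉W  | _       = ⊥-elim (¬detour (λ x∈W → ⊥-elim (x∉W x∈W)))
        ... | no _     | no _     | yes _   | no y∉W  = ⊥-elim (¬detour (λ _ y∈W → ⊥-elim (y∉W y∈W)))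
        ... | no i≢x   | no i≢y   | yes x∈W | yes y∈W =
          ⊥-elim (¬sep (inj₁ (x , i , x∈∁p⇒x∉p x∈W , x∈∁p⇒x∉p i∈W , x↛i)))
          where
            x↛i : ¬ Reach Γ (∁ T) x i
            x↛i r with leave-pair r (inj₁ refl) i≢x i≢y
            ... | c , c∈W , c≢x , c≢y , Γcx = ¬detour (detour-via c∈W c≢x c≢y Γcx)

  twinEdgeDeletion-lowers-κ⇒complete :
    Symmetric Γ → Irreflexive _≡_ Γ → Decidable Γ → 2 ≤ n → IsConnected Γ →
    ∀ {x y} → x ≢ y → Twins x y → Twins y x →
    ∀ {k} → IsVertexConnectivity Γ k → IsVertexConnectivity (DeleteEdge Γ x y) (k ∸ 1) → IsComplete Γ
  twinEdgeDeletion-lowers-κ⇒complete Γ-sym irrefl Γ? 2≤n connected {x} {y} x≢y x~y y~x κ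
                                     ((T , T-separates′ , ∣T∣≡k∸1) , _) =
    complete-if-¬separating-n∸2 Γ? irrefl λ S ∣S∣≤n∸2 →
      below-κ S (ℕ.≤-trans ∣S∣≤n∸2 (ℕ.≤-trans n∸2≤∣T∣ ∣T∣≤k∸1))
    where
      below-κ = below-connectivity⇒¬separating 2≤n connected κ
      ∣T∣≤k∸1 = ℕ.≤-reflexive ∣T∣≡k∸1
      ∁T⊆xy : ∁ T ⊆ ⁅ x ⁆ ∪ ⁅ y ⁆
      ∁T⊆xy = TwinEdge.deletion-separator⊆ Γ-sym x≢y x~y y~x (below-κ T ∣T∣≤k∸1) T-separates′
      n∸2≤∣T∣ : n ∸ 2 ≤ ∣ T ∣
      n∸2≤∣T∣ = ∣∁T∣≤2⇒n∸2≤∣T∣ {T = T} (ℕ.≤-trans (p⊆q⇒∣p∣≤∣q∣ ∁T⊆xy) (∣⁅a⁆∪⁅b⁆∣≤2 x y))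

  EveryEdgeMeets : Fin n → Set
  EveryEdgeMeets c = ∀ {u w} → Γ u w → u ≢ c → w ≡ c

  dominating⇒connected : Symmetric Γ → ∀ {c} → (∀ z → z ≢ c → Γ z c) → IsConnected Γ
  dominating⇒connected Γ-sym {c} dominates u v = reach-trans (to-c u) (from-c v)
    where
      to-c : ∀ z → Reach Γ ⊤ z c
      to-c z with z ≟ c
      ... | yes refl = here ∈⊤
      ... | no z≢c   = there ∈⊤ (dominates z z≢c) (here ∈⊤)
      from-c : ∀ z → Reach Γ ⊤ c z
      from-c z with z ≟ c
      ... | yes refl = here ∈⊤
      ... | no z≢c   = there ∈⊤ (Γ-sym (dominates z z≢c)) (here ∈⊤)

  dominating⇒complete-if-n≤2 : Symmetric Γ → ∀ {c} → (∀ z → z ≢ c → Γ z c) → n ≤ 2 → IsComplete Γ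
  dominating⇒complete-if-n≤2 Γ-sym {c} dominates n≤2 u v u≢v with u ≟ c | v ≟ c
  ... | yes refl | _        = Γ-sym (dominates v (u≢v ∘ sym))
  ... | no u≢c   | yes refl = dominates u u≢c
  ... | no u≢c   | no v≢c   with fin≤2-pigeonhole n≤2 u v c
  ...   | inj₁ u≡v        = ⊥-elim (u≢v u≡v)
  ...   | inj₂ (inj₁ u≡c) = ⊥-elim (u≢c u≡c)
  ...   | inj₂ (inj₂ v≡c) = ⊥-elim (v≢c v≡c)

  meets⇒⁅c⁆-separates : ∀ {c u v} → EveryEdgeMeets c → u ≢ c → v ≢ c → u ≢ v → IsSeparating Γ ⁅ c ⁆
  meets⇒⁅c⁆-separates {c} {u} {v} meets u≢c v≢c u≢v =
    inj₁ (u , v , u≢c ∘ x∈⁅y⁆⇒x≡y c , v≢c ∘ x∈⁅y⁆⇒x≡y c , stuck)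
    where
      stuck : ¬ Reach Γ (∁ ⁅ c ⁆) u v
      stuck (here _)        = u≢v refl
      stuck (there _ Γuw r) =
        x∈∁p⇒x∉p (reach-source r) (subst (_∈ ⁅ c ⁆) (sym (meets Γuw u≢c)) (x∈⁅x⁆ c))

  meets⇒deletion-isolates : Irreflexive _≡_ Γ → ∀ {c a b} → EveryEdgeMeets c → Γ a b →
                            Σ (Fin n) λ y → y ≢ c × ∀ w → ¬ DeleteEdge Γ a b y w
  meets⇒deletion-isolates irrefl {c} {a} {b} meets Γab with a ≟ c
  ... | yes refl = b , (λ b≡c → irrefl (sym b≡c) Γab) , isolated
    where
      isolated : ∀ w → ¬ DeleteEdge Γ a b b w
      isolated w (Γbw , ¬deleted) = ¬deleted (inj₂ (refl , meets Γbw (λ b≡a → irrefl (sym b≡a) Γab)))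
  ... | no a≢c   = a , a≢c , isolated
    where
      isolated : ∀ w → ¬ DeleteEdge Γ a b a w
      isolated w (Γaw , ¬deleted) = ¬deleted (inj₁ (refl , trans (meets Γaw a≢c) (sym (meets Γab a≢c))))

  star⇒edgeDeletion-lowers-κ : Irreflexive _≡_ Γ → ∀ {c u v} → EveryEdgeMeets c → u ≢ c → v ≢ c → u ≢ v →
                        ∀ k → IsVertexConnectivity Γ k →
                        ∀ a b → IsEdge Γ a b → IsVertexConnectivity (DeleteEdge Γ a b) (k ∸ 1)
  star⇒edgeDeletion-lowers-κ irrefl {c} meets u≢c v≢c u≢v k (_ , minimal) a b Γab
    with meets⇒deletion-isolates irrefl meets Γab
  ... | y , y≢c , isolated = subst (IsVertexConnectivity (DeleteEdge Γ a b)) (sym k∸1≡0)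
                                    (isolated⇒κ≡0 (DeleteEdge Γ a b) (y≢c ∘ sym) isolated)
    where
      k∸1≡0 : k ∸ 1 ≡ 0
      k∸1≡0 = ℕ.m≤n⇒m∸n≡0 (subst (k ≤_) (∣⁅x⁆∣≡1 c)
                 (minimal ⁅ c ⁆ (meets⇒⁅c⁆-separates meets u≢c v≢c u≢v)))

count : ∀ {m} → (Fin m → Bool) → ℕ
count P = sum (λ i → if P i then 1 else 0)

count≤m : ∀ {m} (P : Fin m → Bool) → count P ≤ m
count≤m {zero}  P = z≤n
count≤m {suc m} P with P zero
... | true  = s≤s (count≤m (P ∘ suc))
... | false = ℕ.m≤n⇒m≤1+n (count≤m (P ∘ suc))

count-all : ∀ {m} (P : Fin m → Bool) → (∀ i → T (P i)) → count P ≡ m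
count-all {zero}  P all = refl
count-all {suc m} P all with P zero | all zero
... | true | _ = cong suc (count-all (P ∘ suc) (all ∘ suc))

count-none : ∀ {m} (P : Fin m → Bool) → (∀ i → ¬ T (P i)) → count P ≡ 0
count-none {zero}  P none = refl
count-none {suc m} P none with P zero | none zero
... | false | _ = count-none (P ∘ suc) (none ∘ suc)
... | true  | ¬T = ⊥-elim (¬T _)

count-≟ : ∀ {m} (a : Fin m) → count (λ i → isYes (i ≟ a)) ≡ 1
count-≟ {suc m} a = begin
  count (λ i → isYes (i ≟ a))
    ≡⟨ sum-remove {i = a} (λ i → if isYes (i ≟ a) then 1 else 0) ⟩
  (if isYes (a ≟ a) then 1 else 0) + count (λ j → isYes (punchIn a j ≟ a))
    ≡⟨ cong₂ _+_ a≟a punchIns≢a ⟩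
  1 ∎
  where
    open ≡-Reasoning
    a≟a : (if isYes (a ≟ a) then 1 else 0) ≡ 1
    a≟a with a ≟ a
    ... | yes _  = refl
    ... | no a≢a = ⊥-elim (a≢a refl)
    punchIns≢a : count (λ j → isYes (punchIn a j ≟ a)) ≡ 0
    punchIns≢a = count-none (λ j → isYes (punchIn a j ≟ a)) λ j → punchInᵢ≢i a j ∘ toWitness

count-∨ : ∀ {m} (P Q : Fin m → Bool) → (∀ i → T (P i) → ¬ T (Q i)) →
          count (λ i → P i ∨ Q i) ≡ count P + count Q
count-∨ P Q disjoint =
  trans (sum-cong-≗ pointwise) (∑-distrib-+ (λ i → if P i then 1 else 0) (λ i → if Q i then 1 else 0))
  where
    pointwise : ∀ i → (if P i ∨ Q i then 1 else 0) ≡ (if P i then 1 else 0) + (if Q i then 1 else 0)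
    pointwise i with P i | Q i | disjoint i
    ... | true  | true  | d = ⊥-elim (d _ _)
    ... | true  | false | _ = refl
    ... | false | _     | _ = refl

count-∘-involution : ∀ {m} (P : Fin m → Bool) (f : Fin m → Fin m) → (∀ i → f (f i) ≡ i) →
                     count (P ∘ f) ≡ count P
count-∘-involution P f f∘f≗id = sym (sum-permute _ (permutation f f f∘f≗id f∘f≗id))

module FinGroupPowerGraph {n : ℕ} (G : FinGroup n) where
  open FinGroup G
  open IsGroup isGroup using (assoc; identityˡ; identityʳ; inverseʳ)

  group : Group 0ℓ 0ℓ
  group = record { isGroup = isGroup }

  open GroupProperties group using (inverseʳ-unique; ⁻¹-involutive; loop)
  open LoopProperties loop using (identityˡ-unique)

  pow-+ : ∀ x a b → pow G x (a + b) ≡ pow G x a ∙ pow G x b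
  pow-+ x zero    b = sym (identityˡ _)
  pow-+ x (suc a) b = trans (cong (x ∙_) (pow-+ x a b)) (sym (assoc _ _ _))

  pow-* : ∀ x a b → pow G (pow G x a) b ≡ pow G x (a * b)
  pow-* x a zero    = cong (pow G x) (sym (ℕ.*-zeroʳ a))
  pow-* x a (suc b) = begin
    pow G x a ∙ pow G (pow G x a) b ≡⟨ cong (pow G x a ∙_) (pow-* x a b) ⟩
    pow G x a ∙ pow G x (a * b)     ≡⟨ pow-+ x a (a * b) ⟨
    pow G x (a + a * b)             ≡⟨ cong (pow G x) (ℕ.*-suc a b) ⟨
    pow G x (a * suc b)             ∎
    where open ≡-Reasoning

  pow-ε : ∀ k → pow G ε k ≡ ε
  pow-ε zero    = refl
  pow-ε (suc k) = trans (identityˡ _) (pow-ε k)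

  -- Two of the powers x⁰, …, xⁿ coincide, and their quotient is a positive power equal to ε.
  pow-order : ∀ x → Σ ℕ λ o → pow G x (suc o) ≡ ε
  pow-order x with pigeonhole (ℕ.n<1+n n) (λ i → pow G x (toℕ i))
  ... | i , j , i<j , xⁱ≡xʲ = o , identityˡ-unique _ _ (begin
    pow G x (suc o) ∙ pow G x (toℕ i) ≡⟨ pow-+ x (suc o) (toℕ i) ⟨
    pow G x (suc o + toℕ i)           ≡⟨ cong (pow G x) o+i≡j ⟩
    pow G x (toℕ j)                   ≡⟨ xⁱ≡xʲ ⟨
    pow G x (toℕ i)                   ∎)
    where
      open ≡-Reasoning
      o = toℕ j ∸ suc (toℕ i)
      o+i≡j : suc o + toℕ i ≡ toℕ j
      o+i≡j = trans (cong (_+ toℕ i) (sym (ℕ.+-∸-assoc 1 i<j))) (ℕ.m∸n+n≡m (ℕ.<⇒≤ i<j))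

  pow-mod-order : ∀ {x o} → pow G x (suc o) ≡ ε → ∀ k → pow G x k ≡ pow G x (k % suc o)
  pow-mod-order {x} {o} xᵒ⁺¹≡ε k = begin
    pow G x k                                          ≡⟨ cong (pow G x) (m≡m%n+[m/n]*n k (suc o)) ⟩
    pow G x (k % suc o + k / suc o * suc o)            ≡⟨ pow-+ x (k % suc o) _ ⟩
    pow G x (k % suc o) ∙ pow G x (k / suc o * suc o)  ≡⟨ cong (pow G x (k % suc o) ∙_) period ⟩
    pow G x (k % suc o) ∙ ε                            ≡⟨ identityʳ _ ⟩
    pow G x (k % suc o)                                ∎
    where
      open ≡-Reasoning
      period : pow G x (k / suc o * suc o) ≡ ε
      period = begin
        pow G x (k / suc o * suc o)     ≡⟨ cong (pow G x) (ℕ.*-comm (k / suc o) (suc o)) ⟩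
        pow G x (suc o * (k / suc o))   ≡⟨ pow-* x (suc o) (k / suc o) ⟨
        pow G (pow G x (suc o)) (k / suc o) ≡⟨ cong (λ y → pow G y (k / suc o)) xᵒ⁺¹≡ε ⟩
        pow G ε (k / suc o)             ≡⟨ pow-ε (k / suc o) ⟩
        ε                               ∎

  IsPowerOf : Fin n → Fin n → Set
  IsPowerOf a b = Σ ℕ λ k → 1 ≤ k × a ≡ pow G b k

  isPowerOf-trans : ∀ {a b c} → IsPowerOf a b → IsPowerOf b c → IsPowerOf a c
  isPowerOf-trans {c = c} (k , 1≤k , a≡bᵏ) (m , 1≤m , b≡cᵐ) =
    m * k , ℕ.*-mono-≤ 1≤m 1≤k , trans a≡bᵏ (trans (cong (λ y → pow G y k) b≡cᵐ) (pow-* c m k))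

  ε-isPowerOf : ∀ x → IsPowerOf ε x
  ε-isPowerOf x = suc o , s≤s z≤n , sym xᵒ⁺¹≡ε
    where
      o = proj₁ (pow-order x)
      xᵒ⁺¹≡ε = proj₂ (pow-order x)

  -- With o + 1 the order of x, x⁻¹ = xᵒ = x²ᵒ⁺¹, a positive power even when o = 0.
  ⁻¹-isPowerOf : ∀ x → IsPowerOf (x ⁻¹) x
  ⁻¹-isPowerOf x = suc o + o , s≤s z≤n , (begin
    x ⁻¹                       ≡⟨ inverseʳ-unique x (pow G x o) xᵒ⁺¹≡ε ⟨
    pow G x o                  ≡⟨ identityˡ _ ⟨
    ε ∙ pow G x o              ≡⟨ cong (_∙ pow G x o) xᵒ⁺¹≡ε ⟨
    pow G x (suc o) ∙ pow G x o ≡⟨ pow-+ x (suc o) o ⟨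
    pow G x (suc o + o)        ∎)
    where
      open ≡-Reasoning
      o = proj₁ (pow-order x)
      xᵒ⁺¹≡ε = proj₂ (pow-order x)

  isPowerOf-⁻¹ : ∀ x → IsPowerOf x (x ⁻¹)
  isPowerOf-⁻¹ x = subst (λ y → IsPowerOf y (x ⁻¹)) (⁻¹-involutive x) (⁻¹-isPowerOf (x ⁻¹))

  isPowerOf? : Decidable IsPowerOf
  isPowerOf? a b with pow-order b
  ... | o , bᵒ⁺¹≡ε = map′ from to (any? (λ (j : Fin (suc o)) → a ≟ pow G b (suc (toℕ j))))
    where
      from : (Σ (Fin (suc o)) λ j → a ≡ pow G b (suc (toℕ j))) → IsPowerOf a b
      from (j , a≡bʲ⁺¹) = suc (toℕ j) , s≤s z≤n , a≡bʲ⁺¹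
      to : IsPowerOf a b → Σ (Fin (suc o)) λ j → a ≡ pow G b (suc (toℕ j))
      to (suc t , _ , a≡bᵗ⁺¹) = fromℕ< (m%n<n t (suc o)) , (begin
        a                            ≡⟨ a≡bᵗ⁺¹ ⟩
        b ∙ pow G b t                ≡⟨ cong (b ∙_) (pow-mod-order bᵒ⁺¹≡ε t) ⟩
        b ∙ pow G b (t % suc o)      ≡⟨ cong (λ r → b ∙ pow G b r) (toℕ-fromℕ< (m%n<n t (suc o))) ⟨
        pow G b (suc (toℕ (fromℕ< (m%n<n t (suc o))))) ∎)
        where open ≡-Reasoning

  Γ : Graph n
  Γ = PowerGraph G

  Γ-sym : Symmetric Γ
  Γ-sym (u≢v , inj₁ v∈⟨u⟩) = u≢v ∘ sym , inj₂ v∈⟨u⟩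
  Γ-sym (u≢v , inj₂ u∈⟨v⟩) = u≢v ∘ sym , inj₁ u∈⟨v⟩

  Γ-irrefl : Irreflexive _≡_ Γ
  Γ-irrefl u≡v (u≢v , _) = u≢v u≡v

  Γ? : Decidable Γ
  Γ? u v with u ≟ v | isPowerOf? v u | isPowerOf? u v
  ... | yes u≡v | _      | _      = no (Γ-irrefl u≡v)
  ... | no u≢v  | yes p  | _      = yes (u≢v , inj₁ p)
  ... | no u≢v  | no _   | yes q  = yes (u≢v , inj₂ q)
  ... | no _    | no ¬p  | no ¬q  = no λ { (_ , inj₁ p) → ¬p p ; (_ , inj₂ q) → ¬q q }

  adjacent-ε : ∀ z → z ≢ ε → Γ z ε
  adjacent-ε z z≢ε = z≢ε , inj₁ (ε-isPowerOf z)

  open GraphProperties Γ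
    using (Twins; twinEdgeDeletion-lowers-κ⇒complete; ¬¬-vertexConnectivity)

  mutualPowers⇒twins : ∀ {a b} → IsPowerOf a b → IsPowerOf b a → Twins a b
  mutualPowers⇒twins _      b∈⟨a⟩ z≢b (_ , inj₁ a∈⟨z⟩) = z≢b , inj₁ (isPowerOf-trans b∈⟨a⟩ a∈⟨z⟩)
  mutualPowers⇒twins a∈⟨b⟩ _      z≢b (_ , inj₂ z∈⟨a⟩) = z≢b , inj₂ (isPowerOf-trans z∈⟨a⟩ a∈⟨b⟩)

  minimallyConnected⇒exponent2 : ¬ IsComplete Γ → IsMinimallyConnected Γ → ∀ x → x ∙ x ≡ ε
  minimallyConnected⇒exponent2 ¬complete (2≤n , connected , minimal) x with x ∙ x ≟ ε
  ... | yes x²≡ε = x²≡ε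
  ... | no x²≢ε  = ⊥-elim (¬¬-vertexConnectivity λ (k , κ) → ¬complete
         (twinEdgeDeletion-lowers-κ⇒complete Γ-sym Γ-irrefl Γ? 2≤n connected x≢x⁻¹
            (mutualPowers⇒twins (isPowerOf-⁻¹ x) (⁻¹-isPowerOf x))
            (mutualPowers⇒twins (⁻¹-isPowerOf x) (isPowerOf-⁻¹ x))
            κ (minimal k κ x (x ⁻¹) (x≢x⁻¹ , inj₁ (⁻¹-isPowerOf x)))))
    where
      x≢x⁻¹ : x ≢ x ⁻¹
      x≢x⁻¹ x≡x⁻¹ = x²≢ε (trans (cong (x ∙_) x≡x⁻¹) (inverseʳ x))

module Exponent2Group {n : ℕ} (G : FinGroup n) (x²≡ε : ∀ x → FinGroup._∙_ G x x ≡ FinGroup.ε G) where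
  open FinGroup G
  open IsGroup isGroup using (assoc; identityˡ; identityʳ)
  open FinGroupPowerGraph G using (group; Γ; Γ-sym; Γ-irrefl; adjacent-ε)
  open GroupProperties group using (inverseʳ-unique; ⁻¹-anti-homo-∙)
  open GraphProperties Γ
    using (EveryEdgeMeets; dominating⇒connected; dominating⇒complete-if-n≤2; star⇒edgeDeletion-lowers-κ)

  x≡x⁻¹ : ∀ x → x ≡ x ⁻¹
  x≡x⁻¹ x = inverseʳ-unique x x (x²≡ε x)

  comm : Commutative _≡_ _∙_
  comm a b = begin
    a ∙ b         ≡⟨ x≡x⁻¹ (a ∙ b) ⟩
    (a ∙ b) ⁻¹    ≡⟨ ⁻¹-anti-homo-∙ a b ⟩
    (b ⁻¹) ∙ (a ⁻¹) ≡⟨ cong₂ _∙_ (x≡x⁻¹ b) (x≡x⁻¹ a) ⟨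
    b ∙ a         ∎
    where open ≡-Reasoning

  x∙[x∙y]≡y : ∀ x y → x ∙ (x ∙ y) ≡ y
  x∙[x∙y]≡y x y = trans (sym (assoc x x y)) (trans (cong (_∙ y) (x²≡ε x)) (identityˡ y))

  [x∙y]∙y≡x : ∀ x y → (x ∙ y) ∙ y ≡ x
  [x∙y]∙y≡x x y = trans (assoc x y y) (trans (cong (x ∙_) (x²≡ε y)) (identityʳ x))

  x∙[y∙z]≡y∙[x∙z] : ∀ x y z → x ∙ (y ∙ z) ≡ y ∙ (x ∙ z)
  x∙[y∙z]≡y∙[x∙z] x y z = trans (sym (assoc x y z)) (trans (cong (_∙ z) (comm x y)) (assoc y x z))

  [x∙y]∙[x∙z]≡y∙z : ∀ x y z → (x ∙ y) ∙ (x ∙ z) ≡ y ∙ z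
  [x∙y]∙[x∙z]≡y∙z x y z =
    trans (assoc x y (x ∙ z)) (trans (cong (x ∙_) (x∙[y∙z]≡y∙[x∙z] y x z)) (x∙[x∙y]≡y x (y ∙ z)))

  pow≡x⊎pow≡ε : ∀ x k → pow G x k ≡ x ⊎ pow G x k ≡ ε
  pow≡x⊎pow≡ε x zero    = inj₂ refl
  pow≡x⊎pow≡ε x (suc k) with pow≡x⊎pow≡ε x k
  ... | inj₁ xᵏ≡x = inj₂ (trans (cong (x ∙_) xᵏ≡x) (x²≡ε x))
  ... | inj₂ xᵏ≡ε = inj₁ (trans (cong (x ∙_) xᵏ≡ε) (identityʳ x))

  every-edge-meets-ε : EveryEdgeMeets ε
  every-edge-meets-ε {u} (u≢w , inj₁ (k , _ , w≡uᵏ)) u≢ε with pow≡x⊎pow≡ε u k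
  ... | inj₁ uᵏ≡u = ⊥-elim (u≢w (sym (trans w≡uᵏ uᵏ≡u)))
  ... | inj₂ uᵏ≡ε = trans w≡uᵏ uᵏ≡ε
  every-edge-meets-ε {w = w} (u≢w , inj₂ (k , _ , u≡wᵏ)) u≢ε with pow≡x⊎pow≡ε w k
  ... | inj₁ wᵏ≡w = ⊥-elim (u≢w (trans u≡wᵏ wᵏ≡w))
  ... | inj₂ wᵏ≡ε = ⊥-elim (u≢ε (trans u≡wᵏ wᵏ≡ε))

  ¬complete×minimallyConnected : 3 ≤ n → ¬ IsComplete Γ × IsMinimallyConnected Γ
  ¬complete×minimallyConnected 3≤n with two-others 3≤n ε
  ... | u , v , u≢ε , v≢ε , u≢v =
      (λ complete → v≢ε (every-edge-meets-ε (complete u v u≢v) u≢ε))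
    , ℕ.≤-trans (ℕ.n≤1+n 2) 3≤n
    , dominating⇒connected Γ-sym adjacent-ε
    , star⇒edgeDeletion-lowers-κ Γ-irrefl every-edge-meets-ε u≢ε v≢ε u≢v

  complete-if-n≤2 : n ≤ 2 → IsComplete Γ
  complete-if-n≤2 = dominating⇒complete-if-n≤2 Γ-sym adjacent-ε

  -- Inverses are automatic in a group of exponent 2.
  IsSubgroup : (Fin n → Bool) → Set
  IsSubgroup H = T (H ε) × (∀ {a b} → T (H a) → T (H b) → T (H (a ∙ b)))

  -- The extension of H by g ∉ H is H ∪ gH, a disjoint union of two cosets.
  double : ∀ {H} → IsSubgroup H → ∀ {g} → ¬ T (H g) →
           Σ (Fin n → Bool) λ H′ → IsSubgroup H′ × count H′ ≡ count H + count H
  double {H} (ε∈H , closed) {g} g∉H =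
    (λ i → H i ∨ H (g ∙ i)) , (∨-introˡ ε∈H , closed′) , (begin
      count (λ i → H i ∨ H (g ∙ i))  ≡⟨ count-∨ H (H ∘ (g ∙_)) disjoint ⟩
      count H + count (H ∘ (g ∙_))   ≡⟨ cong (count H +_) (count-∘-involution H (g ∙_) (x∙[x∙y]≡y g)) ⟩
      count H + count H              ∎)
    where
      open ≡-Reasoning
      ∨-introˡ : ∀ {b c} → T b → T (b ∨ c)
      ∨-introˡ t = Equivalence.from T-∨ (inj₁ t)
      ∨-introʳ : ∀ {b c} → T c → T (b ∨ c)
      ∨-introʳ t = Equivalence.from T-∨ (inj₂ t)
      in-H : ∀ {a b c} → a ∙ b ≡ c → T (H a) → T (H b) → T (H c)
      in-H a∙b≡c a∈H b∈H = subst (T ∘ H) a∙b≡c (closed a∈H b∈H)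
      disjoint : ∀ i → T (H i) → ¬ T (H (g ∙ i))
      disjoint i i∈H gi∈H = g∉H (in-H ([x∙y]∙y≡x g i) gi∈H i∈H)
      closed′ : ∀ {a b} → T (H a ∨ H (g ∙ a)) → T (H b ∨ H (g ∙ b)) → T (H (a ∙ b) ∨ H (g ∙ (a ∙ b)))
      closed′ {a} {b} a∈H′ b∈H′ with Equivalence.to T-∨ a∈H′ | Equivalence.to T-∨ b∈H′
      ... | inj₁ a∈H  | inj₁ b∈H  = ∨-introˡ (closed a∈H b∈H)
      ... | inj₁ a∈H  | inj₂ gb∈H = ∨-introʳ (in-H (x∙[y∙z]≡y∙[x∙z] a g b) a∈H gb∈H)
      ... | inj₂ ga∈H | inj₁ b∈H  = ∨-introʳ (in-H (assoc g a b) ga∈H b∈H)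
      ... | inj₂ ga∈H | inj₂ gb∈H = ∨-introˡ (in-H ([x∙y]∙[x∙z]≡y∙z g a b) ga∈H gb∈H)

  OrderIsPowerOf2From : ℕ → Set
  OrderIsPowerOf2From d =
    ∀ H → n ∸ count H ≡ d → IsSubgroup H → ∀ r → count H ≡ 2 ^ r → Σ ℕ λ r′ → n ≡ 2 ^ r′

  -- Induction on the index n ∸ |H|: either H is everything, or doubling H shrinks the index.
  orderIsPowerOf2From : ∀ d → OrderIsPowerOf2From d
  orderIsPowerOf2From = <-rec OrderIsPowerOf2From grow
    where
      grow : ∀ d → (∀ {d′} → d′ < d → OrderIsPowerOf2From d′) → OrderIsPowerOf2From d
      grow _ rec H refl H-subgroup r ∣H∣≡2^r with any? (λ g → ¬? (T? (H g)))
      ... | no ¬outside =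
        r , trans (sym (count-all H λ i → decidable-stable (T? (H i)) (¬outside ∘ (i ,_)))) ∣H∣≡2^r
      ... | yes (g , g∉H) with double H-subgroup g∉H
      ...   | H′ , H′-subgroup , ∣H′∣≡2∣H∣ =
        rec (ℕ.∸-monoʳ-< ∣H∣<∣H′∣ (count≤m H′)) H′ refl H′-subgroup (suc r) ∣H′∣≡2^[1+r]
        where
          ∣H∣<∣H′∣ : count H < count H′
          ∣H∣<∣H′∣ = subst (count H <_) (sym ∣H′∣≡2∣H∣)
                      (ℕ.m<m+n (count H) (subst (0 <_) (sym ∣H∣≡2^r) (ℕ.m^n>0 2 r)))
          ∣H′∣≡2^[1+r] : count H′ ≡ 2 ^ suc r
          ∣H′∣≡2^[1+r] = trans ∣H′∣≡2∣H∣
            (trans (cong₂ _+_ ∣H∣≡2^r ∣H∣≡2^r) (cong (2 ^ r +_) (sym (ℕ.+-identityʳ _))))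

  order≡2^r : Σ ℕ λ r → n ≡ 2 ^ r
  order≡2^r = orderIsPowerOf2From _ ε-indicator refl ε-subgroup 0 (count-≟ ε)
    where
      ε-indicator : Fin n → Bool
      ε-indicator i = isYes (i ≟ ε)
      ε-subgroup : IsSubgroup ε-indicator
      ε-subgroup = fromWitness refl , λ a≡ε b≡ε →
        fromWitness (trans (cong₂ _∙_ (toWitness a≡ε) (toWitness b≡ε)) (identityˡ ε))

theorem1p2 : (n : ℕ) (G : FinGroup n) →
    (Σ ℕ λ r → 2 ≤ r × IsElemAbelian2OfRank G r)
      ⇔ (¬ IsComplete (PowerGraph G) × IsMinimallyConnected (PowerGraph G))
theorem1p2 n G = mk⇔ forward backward
  where
    forward : (Σ ℕ λ r → 2 ≤ r × IsElemAbelian2OfRank G r) →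
              ¬ IsComplete (PowerGraph G) × IsMinimallyConnected (PowerGraph G)
    forward (r , 2≤r , _ , x²≡ε , n≡2^r) =
      Exponent2Group.¬complete×minimallyConnected G x²≡ε
        (subst (3 ≤_) (sym n≡2^r) (ℕ.≤-trans (ℕ.n≤1+n 3) (ℕ.^-monoʳ-≤ 2 2≤r)))

    backward : ¬ IsComplete (PowerGraph G) × IsMinimallyConnected (PowerGraph G) →
               Σ ℕ λ r → 2 ≤ r × IsElemAbelian2OfRank G r
    backward (¬complete , minimallyConnected) = r , 2≤r , comm , x²≡ε , n≡2^r
      where
        x²≡ε = FinGroupPowerGraph.minimallyConnected⇒exponent2 G ¬complete minimallyConnected
        open Exponent2Group G x²≡ε using (comm; order≡2^r; complete-if-n≤2)
        r = proj₁ order≡2^r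
        n≡2^r = proj₂ order≡2^r
        2≤r : 2 ≤ r
        2≤r = ℕ.≰⇒> λ r≤1 → ¬complete (complete-if-n≤2 (subst (_≤ 2) (sym n≡2^r) (ℕ.^-monoʳ-≤ 2 r≤1)))
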